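{- Let $\Omega=(G,\mathcal{C})$ be a linear biased graph. Let $C_1$ and $C_2$ be cycles of $G$ such that the edges of $E(C_1)\cap E(C_2)$ induce a path $P$ between vertices $u$ and $v$, and let $P_1,P_2$ be paths with $C_i=P_i\cup P$, $i=1,2$. Let $e_1\in E(P)$ and suppose $T$ is a spanning tree with $E(C_1)\setminus\{e_1\}\subseteq E(T)$ and $E(P_2)\cap E(T)=\emptyset$. Suppose that $C(e,T)$ is balanced for all $e\in E(P_2)$. Then $C_1$ is balanced if and only if $C_2$ is balanced.
   Context: A theta graph consists of three cycles $C_1,C_2,C_3$ with $C_i\triangle C_j=C_k$ for distinct $i,j,k$. A biased graph $\Omega=(G,\mathcal{C})$ is a graph $G$ with a set $\mathcal{C}$ of cycles (balanced; others unbalanced) such that if two cycles of a theta graph lie in $\mathcal{C}$ so does the third. It is linear if every cycle of $G$ expressible as a symmetric difference of cycles of $\mathcal{C}$ belongs to $\mathcal{C}$. For a spanning tree $T$ and $e\notin E(T)$, $C(e,T)$ denotes the unique cycle in $T\cup\{e\}$. -}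

module Defs where

open import Data.Nat using (ℕ)
open import Data.Bool using (_xor_)
open import Data.Fin using (Fin)
open import Data.Fin.Subset public using (Subset; ⊥; ⁅_⁆; _∈_; _∉_; _⊆_; _∪_; _∩_; _-_)
open import Data.Vec using (zipWith)
open import Data.List using (List; []; _∷_; foldr)
open import Data.List.Membership.Propositional using () renaming (_∉_ to _∉ₗ_)
open import Data.List.Relation.Unary.Unique.Propositional using (Unique)
open import Data.Product using (_×_; _,_; Σ; ∃; ∃-syntax)
open import Data.Sum using (_⊎_)
open import Relation.Binary.PropositionalEquality using (_≡_)
open import Relation.Nullary using (¬_)

-- A (multi)graph with vertex set Fin n and edge set Fin m;
-- edge e has (unordered) ends (proj₁ (ends e)) and (proj₂ (ends e)); loops and
-- parallel edges allowed.  Subgraphs / cycles / paths are identified with edge sets.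
record Graph : Set where
  field
    nV : ℕ
    nE : ℕ
    ends : Fin nE → Fin nV × Fin nV

module _ (G : Graph) where
  open Graph G

  EdgeSet : Set
  EdgeSet = Subset nE

  Joins : Fin nE → Fin nV → Fin nV → Set
  Joins e u v = ends e ≡ (u , v) ⊎ ends e ≡ (v , u)

  data Walk : Fin nV → Fin nV → Set where
    nil  : (v : Fin nV) → Walk v v
    cons : {u v w : Fin nV} (e : Fin nE) → Joins e u v → Walk v w → Walk u w

  verts : {u v : Fin nV} → Walk u v → List (Fin nV)
  verts (nil v) = v ∷ []
  verts (cons {u} e _ w) = u ∷ verts w

  edgeList : {u v : Fin nV} → Walk u v → List (Fin nE)
  edgeList (nil v) = []
  edgeList (cons e _ w) = e ∷ edgeList w

  edgeSetOf : List (Fin nE) → EdgeSet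
  edgeSetOf = foldr (λ e S → ⁅ e ⁆ ∪ S) ⊥

  edges : {u v : Fin nV} → Walk u v → EdgeSet
  edges w = edgeSetOf (edgeList w)

  IsPathWalk : {u v : Fin nV} → Walk u v → Set
  IsPathWalk w = Unique (verts w)

  IsPathBetween : Fin nV → Fin nV → EdgeSet → Set
  IsPathBetween u v P = Σ (Walk u v) λ w → IsPathWalk w × edges w ≡ P

  IsPath : EdgeSet → Set
  IsPath P = ∃[ u ] ∃[ v ] IsPathBetween u v P

  -- C is (the edge set of) a cycle: a path from x to v closed up by an extra
  -- edge e (not on the path) joining v and x.  (Loops: x = v and the path is trivial.)
  IsCycle : EdgeSet → Set
  IsCycle C = ∃[ v ] ∃[ x ] Σ (Fin nE) λ e → Σ (Walk x v) λ w →
                Joins e v x × IsPathWalk w × e ∉ₗ edgeList w × C ≡ ⁅ e ⁆ ∪ edges w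

  _△_ : EdgeSet → EdgeSet → EdgeSet
  _△_ = zipWith _xor_

  △-all : List EdgeSet → EdgeSet
  △-all = foldr _△_ ⊥

  -- a biased graph: 𝒞 is a set of cycles satisfying the theta property
  -- (C₁ △ C₂ = C₃ for three cycles forms a theta graph; the condition is
  -- symmetric in the three cycles)
  record IsBiased (𝒞 : EdgeSet → Set) : Set where
    field
      only-cycles : ∀ C → 𝒞 C → IsCycle C
      theta : ∀ C₁ C₂ C₃ → IsCycle C₁ → IsCycle C₂ → IsCycle C₃ → C₁ △ C₂ ≡ C₃ →
              (𝒞 C₁ × 𝒞 C₂ → 𝒞 C₃) × (𝒞 C₁ × 𝒞 C₃ → 𝒞 C₂) × (𝒞 C₂ × 𝒞 C₃ → 𝒞 C₁)

  data AllIn (𝒞 : EdgeSet → Set) : List EdgeSet → Set where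
    []  : AllIn 𝒞 []
    _∷_ : ∀ {C Cs} → 𝒞 C → AllIn 𝒞 Cs → AllIn 𝒞 (C ∷ Cs)

  IsLinear : (𝒞 : EdgeSet → Set) → Set
  IsLinear 𝒞 = ∀ (Cs : List EdgeSet) → AllIn 𝒞 Cs → IsCycle (△-all Cs) → 𝒞 (△-all Cs)

  IsSpanningTree : EdgeSet → Set
  IsSpanningTree T =
    (∀ (u v : Fin nV) → Σ (Walk u v) λ w → edges w ⊆ T) ×
    (∀ C → IsCycle C → ¬ (C ⊆ T))

  -- C is the fundamental cycle C(e,T): the (unique) cycle in T ∪ {e}
  IsFundCycle : EdgeSet → Fin nE → EdgeSet → Set
  IsFundCycle T e C = IsCycle C × C ⊆ T ∪ ⁅ e ⁆

module Submission where

-- We work mod 2: edge sets are Boolean vectors added by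
-- symmetric difference △, and an edge set is even if every vertex has even degree in it.
-- Cycles are even, and a nonempty even set contains a cycle (walk along it until a vertex
-- repeats); so an even set inside an acyclic set is empty, and two even sets that agree
-- outside a spanning tree T are equal.
-- For the theorem let Φ be the sum of the fundamental cycles C(e,T), e ∈ P₂ - e₁.  Outside T,
-- C₁ is {e₁}, Φ is P₂ - e₁ and C₂ = P₂ ∪ P is {e₁} △ (P₂ - e₁); hence C₂ = C₁ △ Φ and
-- C₁ = C₂ △ Φ.  All C(e,T) with e ∈ P₂ are balanced, so by linearity C₁ is balanced iff C₂ is.

open import Defs
open import Data.Nat using (ℕ; zero; suc; _+_; _≤_; _<_; z≤n; s≤s)
open import Data.Nat.Properties using (+-suc; ≮⇒≥; <-irrefl; <-≤-trans; m<m+n)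
open import Data.Bool using (Bool; true; false; _xor_; _∧_; _∨_)
open import Data.Bool.Properties
  using (¬-not; ∨-zeroʳ; ∨-identityʳ; ∧-zeroʳ; ∧-identityʳ; ∧-distribʳ-xor;
         xor-same; xor-comm; xor-assoc; xor-identityʳ; xor-∧-commutativeRing)
open import Data.Fin using (Fin; zero; suc) renaming (_<_ to _<ᶠ_)
open import Data.Fin.Properties using (_≟_; suc-injective; pigeonhole)
open import Data.Fin.Subset.Properties
  using (_∈?_; ∉⊥; x∈⁅x⁆; x∈⁅y⁆⇒x≡y; x∈p∪q⁺; x∈p∪q⁻; x∈p∩q⁺; p⊆p∪q; q⊆p∪q;
         p─⊥≡p; p─q⊆p; x∈p∧x≢y⇒x∈p-y)
open import Data.Vec as Vec using ([]; _∷_; lookup; zipWith; tabulate)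
open import Data.Vec.Properties
  using (lookup-zipWith; lookup-replicate; tabulate∘lookup; tabulate-cong; []=⇒lookup; lookup⇒[]=)
open import Data.List using (List; []; _∷_; foldr; length)
import Data.List as List
open import Data.List.Relation.Unary.All as All using ([]; _∷_)
open import Data.List.Relation.Binary.Subset.Propositional using () renaming (_⊆_ to _⊆ₗ_)
open import Data.List.Membership.Propositional.Properties using (∈-lookup)
open import Data.List.Relation.Unary.Any using (here; there)
open import Data.List.Relation.Unary.All.Properties using (¬Any⇒All¬; All¬⇒¬Any)
open import Data.List.Relation.Unary.AllPairs using ([]; _∷_)
open import Data.List.Relation.Unary.Unique.Propositional using (Unique)
open import Data.List.Membership.Propositional using () renaming (_∈_ to _∈ₗ_; _∉_ to _∉ₗ_)
open import Data.Product using (_×_; _,_; Σ; ∃-syntax; proj₁; proj₂)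
open import Data.Sum using (_⊎_; inj₁; inj₂; map₂)
open import Algebra.Bundles using (CommutativeRing)
open import Algebra.Properties.CommutativeSemigroup
  (CommutativeRing.+-commutativeSemigroup xor-∧-commutativeRing) using (interchange)
open import Function using (_∘_; _⇔_; mk⇔)
open import Relation.Binary.PropositionalEquality
open import Relation.Nullary using (¬_; does; yes; no; contradiction)
open import Relation.Nullary.Decidable using (dec-true; dec-false)

xor-false : ∀ {a b} → a xor b ≡ false → a ≡ b
xor-false {true}  {true}  _ = refl
xor-false {false} {false} _ = refl

not-false : ∀ {b} → true xor b ≡ false → b ≡ true
not-false {true} _ = refl

∧-true : ∀ {a b} → a ∧ b ≡ true → a ≡ true × b ≡ true
∧-true {true} {true} _ = refl , refl

xor-telescope : ∀ a b c → (a xor b) xor (b xor c) ≡ a xor c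
xor-telescope true  true  c     = refl
xor-telescope true  false true  = refl
xor-telescope true  false false = refl
xor-telescope false true  true  = refl
xor-telescope false true  false = refl
xor-telescope false false c     = refl

_==_ : ∀ {n} → Fin n → Fin n → Bool
a == b = does (a ≟ b)

==-refl : ∀ {n} (a : Fin n) → (a == a) ≡ true
==-refl a = dec-true (a ≟ a) refl

==-≢ : ∀ {n} {a b : Fin n} → ¬ a ≡ b → (a == b) ≡ false
==-≢ {a = a} {b} = dec-false (a ≟ b)

lookup-⊥ : ∀ {n} (i : Fin n) → lookup ⊥ i ≡ false
lookup-⊥ i = lookup-replicate i false

lookup-⁅⁆ : ∀ {n} (j i : Fin n) → lookup ⁅ j ⁆ i ≡ (i == j)
lookup-⁅⁆ zero    zero    = refl
lookup-⁅⁆ zero    (suc i) = lookup-⊥ i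
lookup-⁅⁆ (suc j) zero    = refl
lookup-⁅⁆ (suc j) (suc i) = lookup-⁅⁆ j i

lookup-∪ : ∀ {n} (p q : Subset n) i → lookup (p ∪ q) i ≡ lookup p i ∨ lookup q i
lookup-∪ p q i = lookup-zipWith _∨_ i p q

lookup-△ : ∀ {n} (p q : Subset n) i → lookup (zipWith _xor_ p q) i ≡ lookup p i xor lookup q i
lookup-△ p q i = lookup-zipWith _xor_ i p q

lookup-−-self : ∀ {n} (p : Subset n) y → lookup (p - y) y ≡ false
lookup-−-self (b ∷ p) zero    = refl
lookup-−-self (b ∷ p) (suc y) = lookup-−-self p y

lookup-−-other : ∀ {n} (p : Subset n) {i y} → ¬ i ≡ y → lookup (p - y) i ≡ lookup p i
lookup-−-other (b ∷ p) {zero}  {zero}  i≢y = contradiction refl i≢y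
lookup-−-other (b ∷ p) {zero}  {suc y} i≢y = refl
lookup-−-other (b ∷ p) {suc i} {zero}  i≢y = cong (λ q → lookup q i) (p─⊥≡p p)
lookup-−-other (b ∷ p) {suc i} {suc y} i≢y = lookup-−-other p (i≢y ∘ cong suc)

∉⇒lookup-false : ∀ {n} {p : Subset n} {i} → i ∉ p → lookup p i ≡ false
∉⇒lookup-false i∉p = ¬-not (i∉p ∘ lookup⇒[]= _ _)

subset-ext : ∀ {n} (p q : Subset n) → (∀ i → lookup p i ≡ lookup q i) → p ≡ q
subset-ext p q h = begin
  p                    ≡⟨ tabulate∘lookup p ⟨
  tabulate (lookup p)  ≡⟨ tabulate-cong h ⟩
  tabulate (lookup q)  ≡⟨ tabulate∘lookup q ⟩
  q                    ∎
  where open ≡-Reasoning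

infix 4 _≐_off_
_≐_off_ : ∀ {n} → Subset n → Subset n → Subset n → Set
A ≐ B off T = ∀ {g} → g ∉ T → lookup A g ≡ lookup B g

single-off : ∀ {n} {C X T : Subset n} {e} → C - e ⊆ T → e ∈ X → X ⊆ C → X ≐ ⁅ e ⁆ off T
single-off {e = e} C-e⊆T e∈X X⊆C {g} g∉T with g ≟ e
... | yes refl = trans ([]=⇒lookup e∈X) (sym (trans (lookup-⁅⁆ e e) (==-refl e)))
... | no  g≢e  = trans (∉⇒lookup-false (λ g∈X → g∉T (C-e⊆T (x∈p∧x≢y⇒x∈p-y (X⊆C g∈X) g≢e))))
                       (sym (trans (lookup-⁅⁆ e g) (==-≢ g≢e)))

∪-⁅⁆-as-△ : ∀ {n} (p : Subset n) y i → lookup p i ∨ lookup ⁅ y ⁆ i ≡ lookup ⁅ y ⁆ i xor lookup (p - y) i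
∪-⁅⁆-as-△ p y i rewrite lookup-⁅⁆ y i with i ≟ y
... | yes refl rewrite lookup-−-self p i    = ∨-zeroʳ (lookup p i)
... | no  i≢y  rewrite lookup-−-other p i≢y = ∨-identityʳ (lookup p i)

△-cancelʳ : ∀ {n} (A B : Subset n) → zipWith _xor_ (zipWith _xor_ A B) B ≡ A
△-cancelʳ A B = subset-ext _ A λ i → begin
  lookup (zipWith _xor_ (zipWith _xor_ A B) B) i ≡⟨ trans (lookup-△ (zipWith _xor_ A B) B i) (cong (_xor lookup B i) (lookup-△ A B i)) ⟩
  (lookup A i xor lookup B i) xor lookup B i     ≡⟨ xor-assoc (lookup A i) (lookup B i) (lookup B i) ⟩
  lookup A i xor (lookup B i xor lookup B i)     ≡⟨ cong (lookup A i xor_) (xor-same (lookup B i)) ⟩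
  lookup A i xor false                           ≡⟨ xor-identityʳ (lookup A i) ⟩
  lookup A i                                     ∎
  where open ≡-Reasoning

parity : (n : ℕ) → (Fin n → Bool) → Bool
parity zero    h = false
parity (suc n) h = h zero xor parity n (h ∘ suc)

parity-false : ∀ n (h : Fin n → Bool) → (∀ i → h i ≡ false) → parity n h ≡ false
parity-false zero    h z = refl
parity-false (suc n) h z rewrite z zero = parity-false n (h ∘ suc) (z ∘ suc)

parity-cong : ∀ n {h k : Fin n → Bool} → (∀ i → h i ≡ k i) → parity n h ≡ parity n k
parity-cong zero    e = refl
parity-cong (suc n) e = cong₂ _xor_ (e zero) (parity-cong n (e ∘ suc))

parity-xor : ∀ n (h k : Fin n → Bool) →
             parity n (λ i → h i xor k i) ≡ parity n h xor parity n k
parity-xor zero    h k = refl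
parity-xor (suc n) h k rewrite parity-xor n (h ∘ suc) (k ∘ suc) =
  interchange (h zero) (k zero) (parity n (h ∘ suc)) (parity n (k ∘ suc))

parity-single : ∀ n (h : Fin n → Bool) j → (∀ i → ¬ i ≡ j → h i ≡ false) → parity n h ≡ h j
parity-single (suc n) h zero z
  rewrite parity-false n (h ∘ suc) (λ i → z (suc i) λ ()) = xor-identityʳ (h zero)
parity-single (suc n) h (suc j) z rewrite z zero (λ ()) =
  parity-single n (h ∘ suc) j (λ i i≢j → z (suc i) (i≢j ∘ suc-injective))

parity-odd : ∀ n (h : Fin n → Bool) → parity n h ≡ true → ∃[ i ] h i ≡ true
parity-odd (suc n) h odd with h zero in h₀
... | true  = zero , h₀
... | false with parity-odd n (h ∘ suc) odd
...   | i , hi = suc i , hi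

parity-partner : ∀ n (h : Fin n → Bool) j → parity n h ≡ false → h j ≡ true →
                 ∃[ i ] (¬ i ≡ j × h i ≡ true)
parity-partner (suc n) h zero even hj rewrite hj with parity-odd n (h ∘ suc) (not-false even)
... | i , hi = suc i , (λ ()) , hi
parity-partner (suc n) h (suc j) even hj with h zero in h₀
... | true  = zero , (λ ()) , h₀
... | false with parity-partner n (h ∘ suc) j even hj
...   | i , i≢j , hi = suc i , i≢j ∘ suc-injective , hi

unique-length : ∀ {n} (xs : List (Fin n)) → Unique xs → length xs ≤ n
unique-length xs uniq = ≮⇒≥ λ n<len →
  let (i , j , i<j , same) = pigeonhole n<len (List.lookup xs) in distinct xs uniq i j i<j same
  where
  distinct : ∀ {n} (xs : List (Fin n)) → Unique xs → ∀ i j → i <ᶠ j →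
             ¬ List.lookup xs i ≡ List.lookup xs j
  distinct (x ∷ xs) (x∉xs ∷ _)    zero    (suc j) _         = All.lookup x∉xs (∈-lookup j)
  distinct (x ∷ xs) (_ ∷ uniq)    (suc i) (suc j) (s≤s i<j) = distinct xs uniq i j i<j

module Degrees (G : Graph) where
  open Graph G

  -- inc e y: y is an end of the edge e, counted mod 2 (so a loop is incident to nothing).
  inc : Fin nE → Fin nV → Bool
  inc e y = (y == proj₁ (ends e)) xor (y == proj₂ (ends e))

  deg : EdgeSet G → Fin nV → Bool
  deg S y = parity nE (λ e → lookup S e ∧ inc e y)

  Even : EdgeSet G → Set
  Even S = ∀ y → deg S y ≡ false

  inc-joins : ∀ {e a b} → Joins G e a b → ∀ y → inc e y ≡ (y == a) xor (y == b)
  inc-joins (inj₁ eq) y rewrite eq = refl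
  inc-joins {a = a} {b} (inj₂ eq) y rewrite eq = xor-comm (y == b) (y == a)

  deg-△ : ∀ A B y → deg (_△_ G A B) y ≡ deg A y xor deg B y
  deg-△ A B y = trans (parity-cong nE pointwise) (parity-xor nE _ _)
    where
    pointwise : ∀ e → lookup (_△_ G A B) e ∧ inc e y ≡
                      (lookup A e ∧ inc e y) xor (lookup B e ∧ inc e y)
    pointwise e = trans (cong (_∧ inc e y) (lookup-△ A B e))
                        (∧-distribʳ-xor (inc e y) (lookup A e) (lookup B e))

  even-⊥ : Even ⊥
  even-⊥ y = parity-false nE _ (λ e → cong (_∧ inc e y) (lookup-⊥ e))

  deg-⁅⁆ : ∀ e y → deg ⁅ e ⁆ y ≡ inc e y
  deg-⁅⁆ e y = trans (parity-single nE _ e off-e) (cong (_∧ inc e y) (trans (lookup-⁅⁆ e e) (==-refl e)))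
    where
    off-e : ∀ i → ¬ i ≡ e → lookup ⁅ e ⁆ i ∧ inc i y ≡ false
    off-e i i≢e = cong (_∧ inc i y) (trans (lookup-⁅⁆ e i) (==-≢ i≢e))

  even-△ : ∀ A B → Even A → Even B → Even (_△_ G A B)
  even-△ A B evenA evenB y rewrite deg-△ A B y | evenA y | evenB y = refl

  even-△-all : ∀ {Cs} → AllIn G Even Cs → Even (△-all G Cs)
  even-△-all []                    = even-⊥
  even-△-all (_∷_ {C} evenC evens) = even-△ C _ evenC (even-△-all evens)

  xorSet : List (Fin nE) → EdgeSet G
  xorSet = foldr (λ e S → _△_ G ⁅ e ⁆ S) ⊥

  walk-deg : ∀ {a b} (w : Walk G a b) y → deg (xorSet (edgeList G w)) y ≡ (y == a) xor (y == b)
  walk-deg (nil v) y = trans (even-⊥ y) (sym (xor-same (y == v)))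
  walk-deg {a} {b} (cons {v = v} e j w) y = begin
    deg (_△_ G ⁅ e ⁆ (xorSet (edgeList G w))) y        ≡⟨ deg-△ ⁅ e ⁆ _ y ⟩
    deg ⁅ e ⁆ y xor deg (xorSet (edgeList G w)) y      ≡⟨ cong₂ _xor_ (trans (deg-⁅⁆ e y) (inc-joins j y)) (walk-deg w y) ⟩
    ((y == a) xor (y == v)) xor ((y == v) xor (y == b)) ≡⟨ xor-telescope (y == a) (y == v) (y == b) ⟩
    (y == a) xor (y == b)                                ∎
    where open ≡-Reasoning

  edgeSetOf-∈ : ∀ l {g} → g ∈ₗ l → g ∈ edgeSetOf G l
  edgeSetOf-∈ (e ∷ l) (here refl) = x∈p∪q⁺ (inj₁ (x∈⁅x⁆ e))
  edgeSetOf-∈ (e ∷ l) (there g∈l) = x∈p∪q⁺ (inj₂ (edgeSetOf-∈ l g∈l))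

  edgeSetOf-∈⁻ : ∀ l {g} → g ∈ edgeSetOf G l → g ∈ₗ l
  edgeSetOf-∈⁻ []      g∈ = contradiction g∈ ∉⊥
  edgeSetOf-∈⁻ (e ∷ l) g∈ with x∈p∪q⁻ ⁅ e ⁆ (edgeSetOf G l) g∈
  ... | inj₁ g∈⁅e⁆ = here (x∈⁅y⁆⇒x≡y e g∈⁅e⁆)
  ... | inj₂ g∈l   = there (edgeSetOf-∈⁻ l g∈l)

  edgeSetOf-∉ : ∀ l {g} → g ∉ₗ l → lookup (edgeSetOf G l) g ≡ false
  edgeSetOf-∉ l g∉l = ∉⇒lookup-false (g∉l ∘ edgeSetOf-∈⁻ l)

  ∪-new : ∀ e S → lookup S e ≡ false → ⁅ e ⁆ ∪ S ≡ _△_ G ⁅ e ⁆ S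
  ∪-new e S e∉S = subset-ext _ _ λ g →
    trans (lookup-∪ ⁅ e ⁆ S g) (trans (pointwise g) (sym (lookup-△ ⁅ e ⁆ S g)))
    where
    pointwise : ∀ g → lookup ⁅ e ⁆ g ∨ lookup S g ≡ lookup ⁅ e ⁆ g xor lookup S g
    pointwise g rewrite lookup-⁅⁆ e g with g ≟ e
    ... | yes refl rewrite e∉S = refl
    ... | no _ = refl

  edgeSetOf-xorSet : ∀ l → Unique l → edgeSetOf G l ≡ xorSet l
  edgeSetOf-xorSet []      []          = refl
  edgeSetOf-xorSet (e ∷ l) (e∉l ∷ uniq) =
    trans (∪-new e _ (edgeSetOf-∉ l (All¬⇒¬Any e∉l)))
          (cong (_△_ G ⁅ e ⁆) (edgeSetOf-xorSet l uniq))

  head∈verts : ∀ {a b} (w : Walk G a b) → a ∈ₗ verts G w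
  head∈verts (nil v)      = here refl
  head∈verts (cons e j w) = here refl

  edge-ends∈verts : ∀ {a b} (w : Walk G a b) {g} → g ∈ₗ edgeList G w →
                    ∃[ x ] ∃[ y ] (Joins G g x y × x ∈ₗ verts G w × y ∈ₗ verts G w)
  edge-ends∈verts (cons {u} {v} e j w) (here refl) = u , v , j , here refl , there (head∈verts w)
  edge-ends∈verts (cons e j w) (there g∈w) with edge-ends∈verts w g∈w
  ... | x , y , j′ , x∈w , y∈w = x , y , j′ , there x∈w , there y∈w

  joins-end : ∀ {g a b x y} → Joins G g a b → Joins G g x y → a ≡ x ⊎ a ≡ y
  joins-end (inj₁ p) (inj₁ q) = inj₁ (cong proj₁ (trans (sym p) q))
  joins-end (inj₁ p) (inj₂ q) = inj₂ (cong proj₁ (trans (sym p) q))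
  joins-end (inj₂ p) (inj₁ q) = inj₂ (cong proj₂ (trans (sym p) q))
  joins-end (inj₂ p) (inj₂ q) = inj₁ (cong proj₂ (trans (sym p) q))

  joins-sym : ∀ {g a b} → Joins G g a b → Joins G g b a
  joins-sym (inj₁ p) = inj₂ p
  joins-sym (inj₂ p) = inj₁ p

  ∉-walk : ∀ {g a b c d} (w : Walk G c d) → Joins G g a b → a ∉ₗ verts G w → g ∉ₗ edgeList G w
  ∉-walk w j a∉w g∈w with edge-ends∈verts w g∈w
  ... | x , y , j′ , x∈w , y∈w with joins-end j j′
  ...   | inj₁ refl = a∉w x∈w
  ...   | inj₂ refl = a∉w y∈w

  path-edges-unique : ∀ {a b} (w : Walk G a b) → IsPathWalk G w → Unique (edgeList G w)
  path-edges-unique (nil v)      _           = []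
  path-edges-unique (cons e j w) (a∉w ∷ path) =
    ¬Any⇒All¬ _ (∉-walk w j (All¬⇒¬Any a∉w)) ∷ path-edges-unique w path

  cycle-even : ∀ {C} → IsCycle G C → Even C
  cycle-even (v , x , e , w , j , path , e∉w , refl) y = begin
    deg (⁅ e ⁆ ∪ edges G w) y                          ≡⟨ cong (λ S → deg S y) as-sum ⟩
    deg (_△_ G ⁅ e ⁆ (xorSet (edgeList G w))) y         ≡⟨ deg-△ ⁅ e ⁆ _ y ⟩
    deg ⁅ e ⁆ y xor deg (xorSet (edgeList G w)) y       ≡⟨ cong₂ _xor_ (trans (deg-⁅⁆ e y) (inc-joins j y)) (walk-deg w y) ⟩
    ((y == v) xor (y == x)) xor ((y == x) xor (y == v)) ≡⟨ xor-telescope (y == v) (y == x) (y == v) ⟩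
    (y == v) xor (y == v)                                ≡⟨ xor-same (y == v) ⟩
    false                                                ∎
    where
    open ≡-Reasoning
    as-sum : ⁅ e ⁆ ∪ edges G w ≡ _△_ G ⁅ e ⁆ (xorSet (edgeList G w))
    as-sum = trans (∪-new e _ (edgeSetOf-∉ _ e∉w))
                   (cong (_△_ G ⁅ e ⁆) (edgeSetOf-xorSet _ (path-edges-unique w path)))

module Cycles (G : Graph) where
  open Graph G
  open Degrees G
  open import Data.List.Membership.DecPropositional (_≟_ {n = nV}) using () renaming (_∈?_ to _∈ₗ?_)

  prefix : ∀ {a b x} (w : Walk G a b) → x ∈ₗ verts G w →
           Σ (Walk G a x) λ r → verts G r ⊆ₗ verts G w × edgeList G r ⊆ₗ edgeList G w ×
                                (IsPathWalk G w → IsPathWalk G r)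
  prefix (nil v)          (here refl) = nil v , (λ x∈ → x∈) , (λ g∈ → g∈) , (λ path → path)
  prefix (cons {a} e j w) (here refl) =
    nil a , (λ { (here refl) → here refl }) , (λ ()) , (λ _ → [] ∷ [])
  prefix (cons e j w)     (there x∈w) with prefix w x∈w
  ... | r , vs , es , path =
    cons e j r , (λ { (here refl) → here refl ; (there y∈r) → there (vs y∈r) })
               , (λ { (here refl) → here refl ; (there g∈r) → there (es g∈r) })
               , (λ { (a∉w ∷ pw) → ¬Any⇒All¬ _ (All¬⇒¬Any a∉w ∘ vs) ∷ path pw })

  suffix : ∀ {a b x} (w : Walk G a b) → x ∈ₗ verts G w →
           Σ (Walk G x b) λ r → edgeList G r ⊆ₗ edgeList G w × (IsPathWalk G w → IsPathWalk G r)
  suffix (nil v)      (here refl) = nil v , (λ g∈ → g∈) , (λ path → path)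
  suffix (cons e j w) (here refl) = cons e j w , (λ g∈ → g∈) , (λ path → path)
  suffix (cons e j w) (there x∈w) with suffix w x∈w
  ... | r , es , path = r , there ∘ es , (λ { (_ ∷ pw) → path pw })

  walk→path : ∀ {a b} (w : Walk G a b) →
              Σ (Walk G a b) λ p → IsPathWalk G p × edgeList G p ⊆ₗ edgeList G w
  walk→path (nil v) = nil v , [] ∷ [] , (λ g∈ → g∈)
  walk→path (cons {a} e j w) with walk→path w
  ... | p , pathp , es with a ∈ₗ? verts G p
  ...   | yes a∈p = let (r , es′ , pathr) = suffix p a∈p in r , pathr pathp , there ∘ es ∘ es′
  ...   | no  a∉p = cons e j p , ¬Any⇒All¬ _ a∉p ∷ pathp
                  , (λ { (here refl) → here refl ; (there g∈p) → there (es g∈p) })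

  other-end : ∀ g z → inc g z ≡ true → ∃[ z′ ] (Joins G g z z′ × ¬ z′ ≡ z)
  other-end g z inc≡true with z ≟ proj₁ (ends g) | z ≟ proj₂ (ends g)
  ... | yes refl | no z≢b  = proj₂ (ends g) , inj₁ refl , z≢b ∘ sym
  ... | no z≢a   | yes refl = proj₁ (ends g) , inj₂ refl , z≢a ∘ sym

  CycleIn : EdgeSet G → Set
  CycleIn S = ∃[ C ] (IsCycle G C × C ⊆ S)

  -- A path starting with the edge f at z, together with a different edge g from z to a
  -- later vertex z′ of the path, contains a cycle (g followed by the path from z to z′).
  close-cycle : ∀ {z z₁ x z′ f g} (j : Joins G f z z₁) (w : Walk G z₁ x) → IsPathWalk G (cons f j w) →
                Joins G g z z′ → ¬ g ≡ f → z′ ∈ₗ verts G w → CycleIn (⁅ g ⁆ ∪ edges G (cons f j w))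
  close-cycle {g = g} j w (z∉w ∷ pathw) jg g≢f z′∈w with prefix w z′∈w
  ... | r , vs , es , pathr = ⁅ g ⁆ ∪ edges G (cons _ j r)
                            , (_ , _ , g , cons _ j r , joins-sym jg , pathr′ , g∉r , refl)
                            , λ h∈C → x∈p∪q⁺ (map₂ shorter (x∈p∪q⁻ ⁅ g ⁆ _ h∈C))
    where
    pathr′ : IsPathWalk G (cons _ j r)
    pathr′ = ¬Any⇒All¬ _ (All¬⇒¬Any z∉w ∘ vs) ∷ pathr pathw
    g∉r : g ∉ₗ edgeList G (cons _ j r)
    g∉r (here g≡f)  = g≢f g≡f
    g∉r (there g∈r) = ∉-walk w jg (All¬⇒¬Any z∉w) (es g∈r)
    shorter : ∀ {h} → h ∈ edges G (cons _ j r) → h ∈ edges G (cons _ j w)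
    shorter h∈r with edgeSetOf-∈⁻ (edgeList G (cons _ j r)) h∈r
    ... | here refl  = edgeSetOf-∈ (edgeList G (cons _ j w)) (here refl)
    ... | there h∈r′ = edgeSetOf-∈ (edgeList G (cons _ j w)) (there (es h∈r′))

  module EvenSet (S : EdgeSet G) (even : Even S) where

    data SPath : Set where
      spath : ∀ {z z₁ x} (f : Fin nE) (j : Joins G f z z₁) (w : Walk G z₁ x) →
              IsPathWalk G (cons f j w) → (∀ {g} → g ∈ₗ edgeList G (cons f j w) → g ∈ S) → SPath

    size : SPath → ℕ
    size (spath f j w _ _) = length (verts G (cons f j w))

    ∪-inside : ∀ {g a b} (p : Walk G a b) → g ∈ S → (∀ {h} → h ∈ₗ edgeList G p → h ∈ S) →
               ⁅ g ⁆ ∪ edges G p ⊆ S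
    ∪-inside {g} p g∈S inS h∈ with x∈p∪q⁻ ⁅ g ⁆ _ h∈
    ... | inj₁ h∈g = subst (_∈ S) (sym (x∈⁅y⁆⇒x≡y g h∈g)) g∈S
    ... | inj₂ h∈p = inS (edgeSetOf-∈⁻ _ h∈p)

    -- At the start z of an S-path, evenness of S provides a second S-edge g at z.  If g leads
    -- back onto the path it closes a cycle in S; otherwise it extends the path by one vertex.
    extend : (p : SPath) → CycleIn S ⊎ Σ SPath (λ q → size q ≡ suc (size p))
    extend (spath {z} f j w path@(z∉w ∷ _) inS)
      with parity-partner nE _ f (even z) f-at-z
      where
      f-at-z : lookup S f ∧ inc f z ≡ true
      f-at-z rewrite []=⇒lookup (inS (here refl)) | inc-joins j z | ==-refl z
                   | ==-≢ (All.lookup z∉w (head∈verts w)) = refl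
    ... | g , g≢f , g-at-z with ∧-true g-at-z
    ...   | g∈S , g-inc with other-end g z g-inc
    ...     | z′ , jg , z′≢z with z′ ∈ₗ? verts G w
    ...       | yes z′∈w = inj₁ (inside-S (close-cycle j w path jg g≢f z′∈w))
      where
      inside-S : CycleIn (⁅ g ⁆ ∪ edges G (cons f j w)) → CycleIn S
      inside-S (C , cyc , C⊆) = C , cyc , ∪-inside (cons f j w) (lookup⇒[]= g S g∈S) inS ∘ C⊆
    ...       | no  z′∉w = inj₂ (spath g (joins-sym jg) (cons f j w) longer inS′ , refl)
      where
      longer : IsPathWalk G (cons g (joins-sym jg) (cons f j w))
      longer = ¬Any⇒All¬ _ (λ { (here z′≡z) → z′≢z z′≡z ; (there z′∈w′) → z′∉w z′∈w′ }) ∷ path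
      inS′ : ∀ {h} → h ∈ₗ edgeList G (cons g (joins-sym jg) (cons f j w)) → h ∈ S
      inS′ (here refl) = lookup⇒[]= g S g∈S
      inS′ (there h∈) = inS h∈

    -- Extending repeatedly must close a cycle, since a path has at most nV vertices.
    grow : ∀ k (p : SPath) → nV < k + size p → CycleIn S
    grow zero    (spath f j w path _) bound =
      contradiction (<-≤-trans bound (unique-length _ path)) (<-irrefl refl)
    grow (suc k) p bound with extend p
    ... | inj₁ cycle          = cycle
    ... | inj₂ (q , q-longer) = grow k q (subst (nV <_) (sym k+size-q) bound)
      where
      k+size-q : k + size q ≡ suc k + size p
      k+size-q = trans (cong (k +_) q-longer) (+-suc k (size p))

    -- A loop in S is a cycle; any other edge of S starts an S-path, which grows to a cycle.
    even-cycle : ∀ {e} → e ∈ S → CycleIn S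
    even-cycle {e} e∈S with proj₁ (ends e) ≟ proj₂ (ends e)
    ... | yes a≡b = ⁅ e ⁆ ∪ ⊥ , loop , ∪-inside (nil a) e∈S (λ ())
      where
      a = proj₁ (ends e)
      loop : IsCycle G (⁅ e ⁆ ∪ ⊥)
      loop = a , a , e , nil a , inj₁ (cong (a ,_) (sym a≡b)) , [] ∷ [] , (λ ()) , refl
    ... | no  a≢b = grow nV (spath e (inj₁ refl) (nil _) ((a≢b ∷ []) ∷ [] ∷ []) λ { (here refl) → e∈S })
                         (m<m+n nV (s≤s z≤n))

module Trees (G : Graph) where
  open Graph G
  open Degrees G
  open Cycles G

  Acyclic : EdgeSet G → Set
  Acyclic T = ∀ C → IsCycle G C → ¬ C ⊆ T

  -- An even edge set contained in an acyclic one is empty, since it would contain a cycle.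
  even⊆acyclic⇒empty : ∀ {T D} → Acyclic T → Even D → D ⊆ T → ∀ g → g ∉ D
  even⊆acyclic⇒empty acyclic evenD D⊆T g g∈D with EvenSet.even-cycle _ evenD g∈D
  ... | C , cyc , C⊆D = acyclic C cyc (D⊆T ∘ C⊆D)

  -- Two even edge sets that agree outside an acyclic set are equal: their sum is even
  -- and lies inside the acyclic set.
  even-agree : ∀ {T A B} → Acyclic T → Even A → Even B → A ≐ B off T → A ≡ B
  even-agree {T} {A} {B} acyclic evenA evenB A≐B = subset-ext A B λ g →
    xor-false (trans (sym (lookup-△ A B g))
                     (∉⇒lookup-false (even⊆acyclic⇒empty acyclic (even-△ A B evenA evenB) sum⊆T g)))
    where
    sum⊆T : _△_ G A B ⊆ T
    sum⊆T {h} h∈sum with h ∈? T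
    ... | yes h∈T = h∈T
    ... | no  h∉T = contradiction (begin
      true                      ≡⟨ []=⇒lookup h∈sum ⟨
      lookup (_△_ G A B) h      ≡⟨ lookup-△ A B h ⟩
      lookup A h xor lookup B h ≡⟨ cong (_xor lookup B h) (A≐B h∉T) ⟩
      lookup B h xor lookup B h ≡⟨ xor-same (lookup B h) ⟩
      false                     ∎) λ ()
      where open ≡-Reasoning

  select : ∀ {n} → Subset n → (Fin n → EdgeSet G) → List (EdgeSet G)
  select []          F = []
  select (true ∷ S)  F = F zero ∷ select S (F ∘ suc)
  select (false ∷ S) F = select S (F ∘ suc)

  select-AllIn : ∀ {n} (𝒫 : EdgeSet G → Set) (S : Subset n) (F : Fin n → EdgeSet G) →
                 (∀ {i} → i ∈ S → 𝒫 (F i)) → AllIn G 𝒫 (select S F)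
  select-AllIn 𝒫 []          F h = []
  select-AllIn 𝒫 (true ∷ S)  F h = h Vec.here ∷ select-AllIn 𝒫 S (F ∘ suc) (h ∘ Vec.there)
  select-AllIn 𝒫 (false ∷ S) F h = select-AllIn 𝒫 S (F ∘ suc) (h ∘ Vec.there)

  lookup-sum-select : ∀ {n} (S : Subset n) (F : Fin n → EdgeSet G) g →
                      lookup (△-all G (select S F)) g ≡ parity n (λ i → lookup S i ∧ lookup (F i) g)
  lookup-sum-select []          F g = lookup-⊥ g
  lookup-sum-select (true ∷ S)  F g =
    trans (lookup-△ (F zero) _ g) (cong (lookup (F zero) g xor_) (lookup-sum-select S (F ∘ suc) g))
  lookup-sum-select (false ∷ S) F g = lookup-sum-select S (F ∘ suc) g

  module Fundamental (T : EdgeSet G) (tree : IsSpanningTree G T) where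

    tree-path : ∀ e → Σ (Walk G (proj₂ (ends e)) (proj₁ (ends e))) λ p →
                      IsPathWalk G p × (∀ {g} → g ∈ₗ edgeList G p → g ∈ T)
    tree-path e with proj₁ tree (proj₂ (ends e)) (proj₁ (ends e))
    ... | w , w⊆T with walk→path w
    ...   | p , path , p⊆w = p , path , w⊆T ∘ edgeSetOf-∈ _ ∘ p⊆w

    fund : Fin nE → EdgeSet G
    fund e = ⁅ e ⁆ ∪ edges G (proj₁ (tree-path e))

    fund-cycle : ∀ {e} → e ∉ T → IsCycle G (fund e)
    fund-cycle {e} e∉T =
      let (p , path , p⊆T) = tree-path e
      in proj₁ (ends e) , proj₂ (ends e) , e , p , inj₁ refl , path , e∉T ∘ p⊆T , refl

    fund-⊆ : ∀ e → fund e ⊆ T ∪ ⁅ e ⁆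
    fund-⊆ e h∈ with x∈p∪q⁻ ⁅ e ⁆ _ h∈
    ... | inj₁ h∈e = q⊆p∪q T ⁅ e ⁆ h∈e
    ... | inj₂ h∈p = p⊆p∪q ⁅ e ⁆ (proj₂ (proj₂ (tree-path e)) (edgeSetOf-∈⁻ _ h∈p))

    fund-off : ∀ e → fund e ≐ ⁅ e ⁆ off T
    fund-off e {g} g∉T = trans (lookup-∪ ⁅ e ⁆ _ g)
      (trans (cong (lookup ⁅ e ⁆ g ∨_) (∉⇒lookup-false (g∉T ∘ proj₂ (proj₂ (tree-path e)) ∘ edgeSetOf-∈⁻ _)))
             (∨-identityʳ (lookup ⁅ e ⁆ g)))

    fundSum : EdgeSet G → EdgeSet G
    fundSum S = △-all G (select S fund)

    fundSum-off : ∀ S → fundSum S ≐ S off T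
    fundSum-off S {g} g∉T = begin
      lookup (fundSum S) g                              ≡⟨ lookup-sum-select S fund g ⟩
      parity nE (λ i → lookup S i ∧ lookup (fund i) g)  ≡⟨ parity-cong nE (λ i → cong (lookup S i ∧_) (fund-off i g∉T)) ⟩
      parity nE (λ i → lookup S i ∧ lookup ⁅ i ⁆ g)     ≡⟨ parity-single nE _ g off-g ⟩
      lookup S g ∧ lookup ⁅ g ⁆ g                       ≡⟨ cong (lookup S g ∧_) (trans (lookup-⁅⁆ g g) (==-refl g)) ⟩
      lookup S g ∧ true                                 ≡⟨ ∧-identityʳ (lookup S g) ⟩
      lookup S g                                        ∎
      where
      open ≡-Reasoning
      off-g : ∀ i → ¬ i ≡ g → lookup S i ∧ lookup ⁅ i ⁆ g ≡ false
      off-g i i≢g = trans (cong (lookup S i ∧_) (trans (lookup-⁅⁆ i g) (==-≢ (i≢g ∘ sym))))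
                          (∧-zeroʳ (lookup S i))

    fundSum-even : ∀ S → (∀ {i} → i ∈ S → i ∉ T) → Even (fundSum S)
    fundSum-even S S∩T≡∅ = even-△-all (select-AllIn Even S fund (cycle-even ∘ fund-cycle ∘ S∩T≡∅))

    fundSum-balanced : ∀ (𝒞 : EdgeSet G → Set) S → (∀ {i} → i ∈ S → i ∉ T) →
                       (∀ e C → e ∈ S → IsFundCycle G T e C → 𝒞 C) → AllIn G 𝒞 (select S fund)
    fundSum-balanced 𝒞 S S∩T≡∅ balanced = select-AllIn 𝒞 S fund λ i∈S →
      balanced _ _ i∈S (fund-cycle (S∩T≡∅ i∈S) , fund-⊆ _)

    -- The decomposition behind Lemma 3.3.  If C₁ meets the complement of T only in e₁, and
    -- C₂ = Q ∪ P with e₁ ∈ P ⊆ C₁ and Q outside T, then C₂ is C₁ plus the fundamental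
    -- cycles of Q - e₁: both sides are even and they agree outside the tree.
    cycle-decomposition : ∀ {C₁ C₂ P Q e₁} → IsCycle G C₁ → IsCycle G C₂ → C₁ - e₁ ⊆ T →
                          e₁ ∈ P → P ⊆ C₁ → C₂ ≡ Q ∪ P → (∀ {i} → i ∈ Q → i ∉ T) →
                          C₂ ≡ _△_ G C₁ (fundSum (Q - e₁))
    cycle-decomposition {C₁} {C₂} {P} {Q} {e₁} cyc₁ cyc₂ C₁-e₁⊆T e₁∈P P⊆C₁ C₂≡Q∪P Q∩T≡∅ =
      even-agree (proj₂ tree) (cycle-even cyc₂) (even-△ C₁ Φ (cycle-even cyc₁) Φ-even) C₂≐C₁+Φ
      where
      Φ : EdgeSet G
      Φ = fundSum (Q - e₁)
      Φ-even : Even Φ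
      Φ-even = fundSum-even (Q - e₁) (Q∩T≡∅ ∘ p─q⊆p Q ⁅ e₁ ⁆)
      C₂≐C₁+Φ : C₂ ≐ _△_ G C₁ Φ off T
      C₂≐C₁+Φ {g} g∉T = begin
        lookup C₂ g                      ≡⟨ trans (cong (λ X → lookup X g) C₂≡Q∪P) (lookup-∪ Q P g) ⟩
        lookup Q g ∨ lookup P g          ≡⟨ cong (lookup Q g ∨_) (single-off C₁-e₁⊆T e₁∈P P⊆C₁ g∉T) ⟩
        lookup Q g ∨ lookup ⁅ e₁ ⁆ g     ≡⟨ ∪-⁅⁆-as-△ Q e₁ g ⟩
        lookup ⁅ e₁ ⁆ g xor lookup (Q - e₁) g
          ≡⟨ cong₂ _xor_ (single-off C₁-e₁⊆T (P⊆C₁ e₁∈P) (λ g∈ → g∈) g∉T) (fundSum-off (Q - e₁) g∉T) ⟨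
        lookup C₁ g xor lookup Φ g       ≡⟨ lookup-△ C₁ Φ g ⟨
        lookup (_△_ G C₁ Φ) g            ∎
        where open ≡-Reasoning

balanced-sum : ∀ {G 𝒞 A B Cs} → IsLinear G 𝒞 → 𝒞 A → AllIn G 𝒞 Cs →
               B ≡ _△_ G A (△-all G Cs) → IsCycle G B → 𝒞 B
balanced-sum linear balA balCs refl cycB = linear (_ ∷ _) (balA ∷ balCs) cycB

lemma3p3 : (G : Graph) (𝒞 : Subset (Graph.nE G) → Set) →
    IsBiased G 𝒞 → IsLinear G 𝒞 →
    (C₁ C₂ P P₁ P₂ T : Subset (Graph.nE G)) (u v : Fin (Graph.nV G)) (e₁ : Fin (Graph.nE G)) →
    IsCycle G C₁ → IsCycle G C₂ →
    IsPathBetween G u v P → C₁ ∩ C₂ ≡ P →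
    IsPath G P₁ → IsPath G P₂ → C₁ ≡ P₁ ∪ P → C₂ ≡ P₂ ∪ P →
    e₁ ∈ P → IsSpanningTree G T → C₁ - e₁ ⊆ T → P₂ ∩ T ≡ ⊥ →
    (∀ e C → e ∈ P₂ → IsFundCycle G T e C → 𝒞 C) →
    (𝒞 C₁ ⇔ 𝒞 C₂)
lemma3p3 G 𝒞 _ linear C₁ C₂ P P₁ P₂ T _ _ e₁ cyc₁ cyc₂ _ _ _ _ C₁≡P₁∪P C₂≡P₂∪P e₁∈P tree
         C₁-e₁⊆T P₂∩T≡⊥ fund-balanced =
  mk⇔ (λ bal₁ → balanced-sum linear bal₁ Φ-balanced C₂≡C₁+Φ cyc₂)
      (λ bal₂ → balanced-sum linear bal₂ Φ-balanced C₁≡C₂+Φ cyc₁)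
  where
  open Trees G
  open Fundamental T tree
  S⊆P₂ : P₂ - e₁ ⊆ P₂
  S⊆P₂ = p─q⊆p P₂ ⁅ e₁ ⁆
  P₂-off-tree : ∀ {i} → i ∈ P₂ → i ∉ T
  P₂-off-tree i∈P₂ i∈T = ∉⊥ (subst (_ ∈_) P₂∩T≡⊥ (x∈p∩q⁺ (i∈P₂ , i∈T)))
  Φ-balanced : AllIn G 𝒞 (select (P₂ - e₁) fund)
  Φ-balanced = fundSum-balanced 𝒞 (P₂ - e₁) (P₂-off-tree ∘ S⊆P₂) (λ e C → fund-balanced e C ∘ S⊆P₂)
  C₂≡C₁+Φ : C₂ ≡ _△_ G C₁ (fundSum (P₂ - e₁))
  C₂≡C₁+Φ = cycle-decomposition cyc₁ cyc₂ C₁-e₁⊆T e₁∈P (subst (P ⊆_) (sym C₁≡P₁∪P) (q⊆p∪q P₁ P))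
                                C₂≡P₂∪P P₂-off-tree
  C₁≡C₂+Φ : C₁ ≡ _△_ G C₂ (fundSum (P₂ - e₁))
  C₁≡C₂+Φ = trans (sym (△-cancelʳ C₁ _)) (cong (λ X → _△_ G X (fundSum (P₂ - e₁))) (sym C₂≡C₁+Φ))
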